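{- Let $p\geq 3$ be a prime and $d\geq 1$ an integer. Then: (1) A partition in $\Omega_d$ is maximal (with respect to $\prec$) if and only if all of its entries are equal to $2$ or $3$. (2) Every integer $r+1$ with $(d-1)/3\leq r\leq d/2$ occurs exactly once as the length of a maximal partition in $\Omega_d$. (3) There are exactly $\lfloor d/2\rfloor-\lceil (d-4)/3\rceil$ maximal partitions in $\Omega_d$. (4) There is a unique maximal partition in $\Omega_d$ if and only if $d\in\{1,2,3,5\}$.
   Context: $\Omega_d$ is the set of partitions (multisets) of $d+2$ into positive integers $e_1,e_2,\ldots$ with each $e_j\not\equiv 1\bmod p$. The partial order $\prec$ on $\Omega_d$ is defined by $\vec{E}\prec\vec{E}'$ if $\vec{E}'$ is a refinement of $\vec{E}$, i.e. the entries of $\vec{E}'$ can be divided into disjoint subsets whose sums are in bijection with the entries of $\vec{E}$. A partition is maximal if no element of $\Omega_d$ other than itself is a refinement of it. -}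

module Defs where

open import Data.Nat using (ℕ; zero; suc; _+_; _∸_; _≤_)
open import Data.Nat.Divisibility using (_∣_)
open import Data.Integer as ℤ using (ℤ)
open import Data.Integer.DivMod using (_/ℕ_)
open import Data.List using (List; map; concat)
open import Data.Nat.ListAction using (sum)
open import Data.List.Relation.Unary.All using (All)
open import Data.List.Relation.Binary.Permutation.Propositional using (_↭_)
open import Data.Product using (_×_; ∃)
open import Relation.Binary.PropositionalEquality using (_≡_)
open import Relation.Nullary using (¬_)

-- Partitions (multisets of positive integers) are represented as lists,
-- considered up to permutation (_↭_).

-- e is a positive integer with e ≢ 1 (mod p)   (for e ≥ 1: e ≡ 1 mod p iff p ∣ e - 1)
AdmissibleEntry : ℕ → ℕ → Set
AdmissibleEntry p e = (1 ≤ e) × ¬ (p ∣ (e ∸ 1))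

InΩ : ℕ → ℕ → List ℕ → Set
InΩ p d E = All (AdmissibleEntry p) E × (sum E ≡ d + 2)

-- E' is a refinement of E (i.e. E ≺ E'): the entries of E' can be split
-- into disjoint groups whose sums are (as a multiset) the entries of E.
Refines : List ℕ → List ℕ → Set
Refines E' E = ∃ λ (L : List (List ℕ)) → (concat L ↭ E') × (map sum L ↭ E)

Maximal : ℕ → ℕ → List ℕ → Set
Maximal p d E = InΩ p d E × (∀ E' → InΩ p d E' → Refines E' E → E' ↭ E)

-- ⌈ a / 3 ⌉ for an integer a  (_/ℕ_ is floor division by a positive natural)
ceilDiv3 : ℤ → ℤ
ceilDiv3 a = ℤ.- ((ℤ.- a) /ℕ 3)

-- Since every admissible entry is at least 2, a block of a refinement that sums to 2 or 3
-- is a single entry; hence partitions into 2s and 3s are maximal. Conversely an admissible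
-- entry e ≥ 4 splits as 2 + (e - 2) or 3 + (e - 3), since p cannot divide both e - 3 and
-- e - 4. A partition of m into 2s and 3s is determined up to order by its length n, and
-- one of length n exists iff 2n ≤ m ≤ 3n; so the maximal partitions correspond to the
-- lengths ⌈(d + 2)/3⌉ ≤ n ≤ ⌊(d + 2)/2⌋, which gives the count. Exchanging 2 + 2 + 2 for
-- 3 + 3 changes the length, so the maximal partition is unique only when no such exchange
-- is possible, i.e. for d + 2 ∈ {3, 4, 5, 7}.
module Submission where

open import Defs
open import Data.Nat using (ℕ; zero; suc; _+_; _*_; _∸_; _≤_; _<_; _/_; _≟_; z≤n; s≤s; NonZero)
open import Data.Nat.Properties
  using (+-comm; *-comm; +-assoc; ≤-reflexive; +-identityʳ; +-cancelˡ-≤; +-cancelʳ-≡; +-monoʳ-≤; +-monoˡ-≤; +-mono-≤;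
         *-monoˡ-≤; ≤-refl; ≤-trans; <-trans; m≤m+n; m≤n+m; n<1+n; m≤n+m∸n; n≤1+n; ≤⇒≯; ≮⇒≥; <⇒≢;
         1+n≢n; m+n∸m≡n; m∸n+n≡m; m≤o∸n⇒m+n≤o; ∸-monoˡ-<; module ≤-Reasoning)
open import Data.Nat.Divisibility using (_∣_; _∣?_; _∣0; 1∣_; ∣-trans; ∣⇒≤; ∣m+n∣m⇒∣n; divides)
open import Data.Nat.DivMod using (m/n*n≤m; m*n/n≡m; /-monoˡ-≤; /-monoʳ-≤; +-distrib-/-∣ʳ)
open import Data.Nat.ListAction using (sum)
open import Data.Nat.ListAction.Properties using (sum-++; sum-↭)
open import Data.Nat.Primality using (Prime)
open import Data.Nat.Tactic.RingSolver using (solve-∀)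
open import Data.Integer as ℤ using (ℤ; +_; _/ℕ_)
import Data.Integer.Properties as ℤ
import Data.Integer.DivMod as ℤ
import Data.Integer.Tactic.RingSolver as ℤ-Ring
open import Data.List using (List; []; _∷_; [_]; _++_; length; map; concat; replicate; applyUpTo)
open import Data.List.Properties
  using (length-++; length-replicate; length-applyUpTo; map-∘; map-cong; map-id; concat-map-[_])
open import Data.List.Membership.Propositional using (find)
open import Data.List.Membership.Propositional.Properties using (∈-∃++)
open import Data.List.Relation.Unary.All as All using (All; []; _∷_; all?)
import Data.List.Relation.Unary.All.Properties as All
open import Data.List.Relation.Unary.Any using (Any; here)
import Data.List.Relation.Unary.Any.Properties as Any
open import Data.List.Relation.Unary.AllPairs using (AllPairs)
import Data.List.Relation.Unary.AllPairs.Properties as AllPairs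
open import Data.List.Relation.Binary.Permutation.Propositional
  using (_↭_; ↭-refl; ↭-reflexive; ↭-sym; ↭-trans; prep)
open import Data.List.Relation.Binary.Permutation.Propositional.Properties
  using (All-resp-↭; ↭-length; shift)
open import Data.Product using (_×_; ∃; ∃₂; _,_; proj₁; proj₂)
open import Data.Sum using (_⊎_; inj₁; inj₂)
open import Function using (_∘_)
open import Function.Bundles using (_⇔_; mk⇔; Equivalence)
open import Relation.Binary.PropositionalEquality
  using (_≡_; _≢_; refl; sym; trans; cong; cong₂; subst; subst₂; module ≡-Reasoning)
open import Relation.Nullary using (¬_; yes; no; contradiction)
open import Relation.Nullary.Decidable using (_⊎-dec_)
open import Relation.Unary using (Decidable)

TwoOrThree : ℕ → Set
TwoOrThree e = e ≡ 2 ⊎ e ≡ 3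

twoOrThree? : Decidable TwoOrThree
twoOrThree? e = e ≟ 2 ⊎-dec e ≟ 3

¬twoOrThree-≥4 : ∀ {e} → 4 ≤ e → ¬ TwoOrThree e
¬twoOrThree-≥4 (s≤s (s≤s ())) (inj₁ refl)
¬twoOrThree-≥4 (s≤s (s≤s (s≤s ()))) (inj₂ refl)

admissible⇒2≤ : ∀ {p e} → AdmissibleEntry p e → 2 ≤ e
admissible⇒2≤ {e = zero} (() , _)
admissible⇒2≤ {p} {e = suc zero} (_ , p∤0) = contradiction (p ∣0) p∤0
admissible⇒2≤ {e = suc (suc _)} _ = s≤s (s≤s z≤n)

refines-split : ∀ {E} e₁ e₂ rest → E ↭ e₁ + e₂ ∷ rest → Refines (e₁ ∷ e₂ ∷ rest) E
refines-split e₁ e₂ rest π =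
    (e₁ ∷ e₂ ∷ []) ∷ map [_] rest
  , ↭-reflexive (cong (λ xs → e₁ ∷ e₂ ∷ xs) (concat-map-[ rest ]))
  , ↭-trans (↭-reflexive (cong₂ _∷_ (cong (_+_ e₁) (+-identityʳ e₂)) sums-of-singletons)) (↭-sym π)
  where
  sums-of-singletons : map sum (map [_] rest) ≡ rest
  sums-of-singletons = trans (sym (map-∘ rest)) (trans (map-cong +-identityʳ rest) (map-id rest))

block-of-2≤-is-singleton : ∀ {xs} → All (2 ≤_) xs → TwoOrThree (sum xs) → xs ≡ [ sum xs ]
block-of-2≤-is-singleton [] (inj₁ ())
block-of-2≤-is-singleton [] (inj₂ ())
block-of-2≤-is-singleton {x ∷ []} _ _ = cong [_] (sym (+-identityʳ x))
block-of-2≤-is-singleton {x ∷ y ∷ ys} (2≤x ∷ 2≤y ∷ _) 2or3 =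
  contradiction 2or3 (¬twoOrThree-≥4 (+-mono-≤ 2≤x (≤-trans 2≤y (m≤m+n y (sum ys)))))

refinement-of-twoOrThree : ∀ {E' E} → All (2 ≤_) E' → All TwoOrThree E → Refines E' E → E' ↭ E
refinement-of-twoOrThree 2≤E' 2or3E (L , concat↭ , sums↭) =
  ↭-trans (↭-sym concat↭) (↭-trans (↭-reflexive (blocks L 2≤L 2or3L)) sums↭)
  where
  2≤L : All (All (2 ≤_)) L
  2≤L = All.concat⁻ (All-resp-↭ (↭-sym concat↭) 2≤E')
  2or3L : All (TwoOrThree ∘ sum) L
  2or3L = All.map⁻ (All-resp-↭ (↭-sym sums↭) 2or3E)
  blocks : ∀ L → All (All (2 ≤_)) L → All (TwoOrThree ∘ sum) L → concat L ≡ map sum L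
  blocks [] [] [] = refl
  blocks (xs ∷ L) (2≤xs ∷ 2≤L) (t ∷ ts) =
    cong₂ _++_ (block-of-2≤-is-singleton 2≤xs t) (blocks L 2≤L ts)

twosThrees : ℕ → ℕ → List ℕ
twosThrees a b = replicate a 2 ++ replicate b 3

sum-replicate : ∀ n x → sum (replicate n x) ≡ n * x
sum-replicate zero x = refl
sum-replicate (suc n) x = cong (_+_ x) (sum-replicate n x)

sum-twosThrees : ∀ a b → sum (twosThrees a b) ≡ a * 2 + b * 3
sum-twosThrees a b =
  trans (sum-++ (replicate a 2) (replicate b 3)) (cong₂ _+_ (sum-replicate a 2) (sum-replicate b 3))

length-twosThrees : ∀ a b → length (twosThrees a b) ≡ a + b
length-twosThrees a b =
  trans (length-++ (replicate a 2)) (cong₂ _+_ (length-replicate a) (length-replicate b))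

twosThrees-twoOrThree : ∀ a b → All TwoOrThree (twosThrees a b)
twosThrees-twoOrThree a b = All.++⁺ (All.replicate⁺ a (inj₁ refl)) (All.replicate⁺ b (inj₂ refl))

↭-twosThrees : ∀ {E} → All TwoOrThree E → ∃₂ λ a b → E ↭ twosThrees a b
↭-twosThrees [] = 0 , 0 , ↭-refl
↭-twosThrees (inj₁ refl ∷ 2or3) with a , b , π ← ↭-twosThrees 2or3 = suc a , b , prep 2 π
↭-twosThrees (inj₂ refl ∷ 2or3) with a , b , π ← ↭-twosThrees 2or3 =
  a , suc b , ↭-trans (prep 3 π) (↭-sym (shift 3 (replicate a 2) (replicate b 3)))

a*2+b*3≡[a+b]*2+b : ∀ a b → a * 2 + b * 3 ≡ (a + b) * 2 + b
a*2+b*3≡[a+b]*2+b = solve-∀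

twosThrees-counts : ∀ a b {n m} → a + b ≡ n → a * 2 + b * 3 ≡ m → a ≡ n * 3 ∸ m × b ≡ m ∸ n * 2
twosThrees-counts a b refl refl =
    sym (trans (cong (_∸ (a * 2 + b * 3)) (threes a b)) (m+n∸m≡n (a * 2 + b * 3) a))
  , sym (trans (cong (_∸ (a + b) * 2) (a*2+b*3≡[a+b]*2+b a b)) (m+n∸m≡n ((a + b) * 2) b))
  where
  threes : ∀ a b → (a + b) * 3 ≡ a * 2 + b * 3 + a
  threes = solve-∀

twosThrees-solution : ∀ {n m} → n * 2 ≤ m → m ≤ n * 3 → ∃₂ λ a b → a + b ≡ n × a * 2 + b * 3 ≡ m
twosThrees-solution {n} {m} n*2≤m m≤n*3 = n ∸ b , b , m∸n+n≡m b≤n , sum≡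
  where
  thrice : ∀ n → n * 3 ≡ n * 2 + n
  thrice = solve-∀
  b : ℕ
  b = m ∸ n * 2
  m≡ : n * 2 + b ≡ m
  m≡ = trans (+-comm (n * 2) b) (m∸n+n≡m n*2≤m)
  b≤n : b ≤ n
  b≤n = +-cancelˡ-≤ (n * 2) b n (≤-trans (≤-reflexive m≡) (≤-trans m≤n*3 (≤-reflexive (thrice n))))
  sum≡ : (n ∸ b) * 2 + b * 3 ≡ m
  sum≡ = trans (a*2+b*3≡[a+b]*2+b (n ∸ b) b) (trans (cong (λ k → k * 2 + b) (m∸n+n≡m b≤n)) m≡)

ofLength : ℕ → ℕ → List ℕ
ofLength m n = twosThrees (n * 3 ∸ m) (m ∸ n * 2)

↭-ofLength : ∀ {E} → All TwoOrThree E → E ↭ ofLength (sum E) (length E)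
↭-ofLength {E} 2or3
  with a , b , π ← ↭-twosThrees 2or3
  with a≡ , b≡ ← twosThrees-counts a b (trans (sym (length-twosThrees a b)) (sym (↭-length π)))
                                       (trans (sym (sum-twosThrees a b)) (sym (sum-↭ π)))
  = subst₂ (λ a b → E ↭ twosThrees a b) a≡ b≡ π

twoOrThree-↭ : ∀ {E E'} → All TwoOrThree E → All TwoOrThree E' →
               sum E ≡ sum E' → length E ≡ length E' → E ↭ E'
twoOrThree-↭ 2or3 2or3' sum≡ length≡ =
  ↭-trans (↭-ofLength 2or3) (subst₂ (λ m n → ofLength m n ↭ _) (sym sum≡) (sym length≡) (↭-sym (↭-ofLength 2or3')))

ofLength-spec : ∀ {n m} → n * 2 ≤ m → m ≤ n * 3 →
                All TwoOrThree (ofLength m n) × sum (ofLength m n) ≡ m × length (ofLength m n) ≡ n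
ofLength-spec {n} {m} n*2≤m m≤n*3
  with a , b , length≡ , sum≡ ← twosThrees-solution n*2≤m m≤n*3
  with a≡ , b≡ ← twosThrees-counts a b length≡ sum≡
  = subst (λ E → All TwoOrThree E × sum E ≡ m × length E ≡ n)
          (cong₂ twosThrees a≡ b≡)
          (twosThrees-twoOrThree a b , trans (sum-twosThrees a b) sum≡ , trans (length-twosThrees a b) length≡)

twoOrThree-sum-bounds : ∀ {E} → All TwoOrThree E → length E * 2 ≤ sum E × sum E ≤ length E * 3
twoOrThree-sum-bounds [] = z≤n , z≤n
twoOrThree-sum-bounds (inj₁ refl ∷ 2or3) with lower , upper ← twoOrThree-sum-bounds 2or3 =
  +-monoʳ-≤ 2 lower , ≤-trans (+-monoʳ-≤ 2 upper) (n≤1+n _)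
twoOrThree-sum-bounds (inj₂ refl ∷ 2or3) with lower , upper ← twoOrThree-sum-bounds 2or3 =
  ≤-trans (n≤1+n _) (+-monoʳ-≤ 3 lower) , +-monoʳ-≤ 3 upper

m≤n/o⇔m*o≤n : ∀ {m n} o .{{_ : NonZero o}} → m ≤ n / o ⇔ m * o ≤ n
m≤n/o⇔m*o≤n {m} {n} o = mk⇔ (λ m≤n/o → ≤-trans (*-monoˡ-≤ o m≤n/o) (m/n*n≤m n o))
                             (λ m*o≤n → subst (_≤ n / o) (m*n/n≡m m o) (/-monoˡ-≤ o m*o≤n))

minLength : ℕ → ℕ
minLength m = (2 + m) / 3

maxLength+1 : ℕ → ℕ
maxLength+1 m = (2 + m) / 2

minLength≤n⇔m≤n*3 : ∀ {m n} → minLength m ≤ n ⇔ m ≤ n * 3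
minLength≤n⇔m≤n*3 {m} {n} = mk⇔
  (λ minLength≤n → ≮⇒≥ λ n*3<m → ≤⇒≯ minLength≤n (Equivalence.from (m≤n/o⇔m*o≤n 3) (+-monoʳ-≤ 2 n*3<m)))
  (λ m≤n*3 → ≮⇒≥ λ n<minLength → ≤⇒≯ (+-monoʳ-≤ 2 m≤n*3) (Equivalence.to (m≤n/o⇔m*o≤n 3) n<minLength))

n<maxLength+1⇔n*2≤m : ∀ {m n} → n < maxLength+1 m ⇔ n * 2 ≤ m
n<maxLength+1⇔n*2≤m {m} {n} = mk⇔
  (λ n<maxLength+1 → +-cancelˡ-≤ 2 (n * 2) m (Equivalence.to (m≤n/o⇔m*o≤n 2) n<maxLength+1))
  (λ n*2≤m → Equivalence.from (m≤n/o⇔m*o≤n 2) (+-monoʳ-≤ 2 n*2≤m))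

minLength≤maxLength+1 : ∀ m → minLength m ≤ maxLength+1 m
minLength≤maxLength+1 m = /-monoʳ-≤ (2 + m) {3} {2} (s≤s (s≤s z≤n))

twoThreePartitions : ℕ → List (List ℕ)
twoThreePartitions m = applyUpTo (λ i → ofLength m (i + minLength m)) (maxLength+1 m ∸ minLength m)

module _ (m : ℕ) where

  private
    bounds-of-index : ∀ {i} → i < maxLength+1 m ∸ minLength m →
                      (i + minLength m) * 2 ≤ m × m ≤ (i + minLength m) * 3
    bounds-of-index {i} i<count =
        Equivalence.to n<maxLength+1⇔n*2≤m (m≤o∸n⇒m+n≤o (suc i) (minLength≤maxLength+1 m) i<count)
      , Equivalence.to minLength≤n⇔m≤n*3 (m≤n+m (minLength m) i)

    spec-of-index : ∀ {i} → i < maxLength+1 m ∸ minLength m →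
      let E = ofLength m (i + minLength m) in All TwoOrThree E × sum E ≡ m × length E ≡ i + minLength m
    spec-of-index i<count = ofLength-spec (proj₁ (bounds-of-index i<count)) (proj₂ (bounds-of-index i<count))

  twoThreePartitions-sound : All (λ E → All TwoOrThree E × sum E ≡ m) (twoThreePartitions m)
  twoThreePartitions-sound = All.applyUpTo⁺₁ _ _ λ i<count →
    let 2or3 , sum≡ , _ = spec-of-index i<count in 2or3 , sum≡

  twoThreePartitions-distinct : AllPairs (λ E E' → ¬ (E ↭ E')) (twoThreePartitions m)
  twoThreePartitions-distinct = AllPairs.applyUpTo⁺₁ _ _ λ {i} {j} i<j j<count π →
    <⇒≢ i<j (+-cancelʳ-≡ (minLength m) i j
      (trans (sym (proj₂ (proj₂ (spec-of-index (<-trans i<j j<count)))))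
             (trans (↭-length π) (proj₂ (proj₂ (spec-of-index j<count))))))

  twoThreePartitions-complete : ∀ {E} → All TwoOrThree E → sum E ≡ m →
                                Any (E ↭_) (twoThreePartitions m)
  twoThreePartitions-complete {E} 2or3 refl = Any.applyUpTo⁺ _ E↭ (∸-monoˡ-< n<maxLength+1 minLength≤n)
    where
    n : ℕ
    n = length E
    minLength≤n : minLength m ≤ n
    minLength≤n = Equivalence.from minLength≤n⇔m≤n*3 (proj₂ (twoOrThree-sum-bounds 2or3))
    n<maxLength+1 : n < maxLength+1 m
    n<maxLength+1 = Equivalence.from n<maxLength+1⇔n*2≤m (proj₁ (twoOrThree-sum-bounds 2or3))
    E↭ : E ↭ ofLength m (n ∸ minLength m + minLength m)
    E↭ = subst (λ k → E ↭ ofLength m k) (sym (m∸n+n≡m minLength≤n)) (↭-ofLength 2or3)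

  length-twoThreePartitions : length (twoThreePartitions m) ≡ maxLength+1 m ∸ minLength m
  length-twoThreePartitions = length-applyUpTo _ _

<suc⇒≤ : ∀ {i j} → i ℤ.< ℤ.suc j → i ℤ.≤ j
<suc⇒≤ {j = j} i<suc[j] = subst (_ ℤ.≤_) (ℤ.pred-suc j) (ℤ.i<j⇒i≤pred[j] i<suc[j])

/ℕ-unique : ∀ {a q} n .{{_ : NonZero n}} → q ℤ.* + n ℤ.≤ a → a ℤ.< ℤ.suc q ℤ.* + n → a /ℕ n ≡ q
/ℕ-unique {a} {q} n lower upper = ℤ.≤-antisym
  (<suc⇒≤ (ℤ.*-cancelʳ-<-nonNeg (+ n) (ℤ.≤-<-trans (ℤ.[n/ℕd]*d≤n a n) upper)))
  (<suc⇒≤ (ℤ.*-cancelʳ-<-nonNeg (+ n) (ℤ.≤-<-trans lower (ℤ.n<s[n/ℕd]*d a n))))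

ceilDiv3-unique : ∀ {x c} → x ℤ.≤ c ℤ.* + 3 → (c ℤ.- + 1) ℤ.* + 3 ℤ.< x → ceilDiv3 x ≡ c
ceilDiv3-unique {x} {c} upper lower = begin
  ℤ.- (ℤ.- x /ℕ 3) ≡⟨ cong ℤ.-_ (/ℕ-unique 3 (subst (ℤ._≤ ℤ.- x) (negate-upper c) (ℤ.neg-mono-≤ upper))
                                              (subst (ℤ.- x ℤ.<_) (negate-lower c) (ℤ.neg-mono-< lower))) ⟩
  ℤ.- (ℤ.- c)      ≡⟨ ℤ.neg-involutive c ⟩
  c                ∎
  where
  open ≡-Reasoning
  negate-upper : ∀ c → ℤ.- (c ℤ.* + 3) ≡ ℤ.- c ℤ.* + 3
  negate-upper = ℤ-Ring.solve-∀
  negate-lower : ∀ c → ℤ.- ((c ℤ.- + 1) ℤ.* + 3) ≡ (+ 1 ℤ.+ ℤ.- c) ℤ.* + 3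
  negate-lower = ℤ-Ring.solve-∀

[i+k]-[j+k]≡i-j : ∀ i j k → i ℤ.+ k ℤ.- (j ℤ.+ k) ≡ i ℤ.- j
[i+k]-[j+k]≡i-j = ℤ-Ring.solve-∀

[i+j]-[j+k]≡i-k : ∀ i j k → i ℤ.+ j ℤ.- (j ℤ.+ k) ≡ i ℤ.- k
[i+j]-[j+k]≡i-k = ℤ-Ring.solve-∀

i+l≤k+j⇒i-j≤k-l : ∀ i j k l → i ℤ.+ l ℤ.≤ k ℤ.+ j → i ℤ.- j ℤ.≤ k ℤ.- l
i+l≤k+j⇒i-j≤k-l i j k l h =
  subst₂ ℤ._≤_ ([i+k]-[j+k]≡i-j i j l) ([i+j]-[j+k]≡i-k k j l) (ℤ.+-monoˡ-≤ (ℤ.- (j ℤ.+ l)) h)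

i+l<k+j⇒i-j<k-l : ∀ i j k l → i ℤ.+ l ℤ.< k ℤ.+ j → i ℤ.- j ℤ.< k ℤ.- l
i+l<k+j⇒i-j<k-l i j k l h =
  subst₂ ℤ._<_ ([i+k]-[j+k]≡i-j i j l) ([i+j]-[j+k]≡i-k k j l) (ℤ.+-monoˡ-< (ℤ.- (j ℤ.+ l)) h)

ceilDiv3[d-4]≡minLength-2 : ∀ d → ceilDiv3 (+ d ℤ.- + 4) ≡ + minLength (d + 2) ℤ.- + 2
ceilDiv3[d-4]≡minLength-2 d = ceilDiv3-unique
  (subst (+ d ℤ.- + 4 ℤ.≤_) (sym (in-ℕ upper-shape)) (i+l≤k+j⇒i-j≤k-l (+ d) (+ 4) (+ (k * 3)) (+ 6) (ℤ.+≤+ upper)))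
  (subst (ℤ._< + d ℤ.- + 4) (sym (in-ℕ lower-shape)) (i+l<k+j⇒i-j<k-l (+ (k * 3)) (+ 9) (+ d) (+ 4) (ℤ.+<+ lower)))
  where
  -- k = ⌈(d + 2)/3⌉ is pinned down by d + 2 ≤ 3k < d + 5.
  k : ℕ
  k = minLength (d + 2)
  upper-shape : ∀ k → (k ℤ.- + 2) ℤ.* + 3 ≡ k ℤ.* + 3 ℤ.- + 6
  upper-shape = ℤ-Ring.solve-∀
  lower-shape : ∀ k → (k ℤ.- + 2 ℤ.- + 1) ℤ.* + 3 ≡ k ℤ.* + 3 ℤ.- + 9
  lower-shape = ℤ-Ring.solve-∀
  in-ℕ : ∀ {f : ℤ → ℤ} {c} → (∀ k → f k ≡ k ℤ.* + 3 ℤ.- c) → f (+ k) ≡ + (k * 3) ℤ.- c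
  in-ℕ {c = c} shape = trans (shape (+ k)) (cong (ℤ._- c) (sym (ℤ.pos-* k 3)))
  upper : d + 6 ≤ k * 3 + 4
  upper = subst (_≤ k * 3 + 4) (+-assoc d 2 4) (+-monoˡ-≤ 4 (Equivalence.to minLength≤n⇔m≤n*3 (≤-refl {k})))
  lower : k * 3 + 4 < d + 9
  lower = begin-strict
    k * 3 + 4         ≤⟨ +-monoˡ-≤ 4 (m/n*n≤m (2 + (d + 2)) 3) ⟩
    2 + (d + 2) + 4   <⟨ n<1+n _ ⟩
    3 + (d + 2) + 4   ≡⟨ regroup d ⟩
    d + 9             ∎
    where
    open ≤-Reasoning
    regroup : ∀ d → 3 + (d + 2) + 4 ≡ d + 9
    regroup = solve-∀

maxLength+1[d+2]≡d/2+2 : ∀ d → maxLength+1 (d + 2) ≡ d / 2 + 2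
maxLength+1[d+2]≡d/2+2 d = trans (cong (_/ 2) (regroup d)) (+-distrib-/-∣ʳ d (divides 2 refl))
  where
  regroup : ∀ d → 2 + (d + 2) ≡ d + 4
  regroup = solve-∀

count-formula : ∀ d → + (maxLength+1 (d + 2) ∸ minLength (d + 2)) ≡ + (d / 2) ℤ.- ceilDiv3 (+ d ℤ.- + 4)
count-formula d = begin
  + (maxLength+1 (d + 2) ∸ k)   ≡⟨ sym (trans (ℤ.m-n≡m⊖n _ k) (ℤ.⊖-≥ (minLength≤maxLength+1 (d + 2)))) ⟩
  + maxLength+1 (d + 2) ℤ.- + k ≡⟨ cong (λ h → + h ℤ.- + k) (maxLength+1[d+2]≡d/2+2 d) ⟩
  + (d / 2) ℤ.+ + 2 ℤ.- + k     ≡⟨ regroup (+ (d / 2)) (+ k) ⟩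
  + (d / 2) ℤ.- (+ k ℤ.- + 2)   ≡⟨ cong (ℤ._-_ (+ (d / 2))) (sym (ceilDiv3[d-4]≡minLength-2 d)) ⟩
  + (d / 2) ℤ.- ceilDiv3 (+ d ℤ.- + 4) ∎
  where
  open ≡-Reasoning
  k : ℕ
  k = minLength (d + 2)
  regroup : ∀ h k → h ℤ.+ + 2 ℤ.- k ≡ h ℤ.- (k ℤ.- + 2)
  regroup = ℤ-Ring.solve-∀

three-twos≡two-threes : ∀ a b → (3 + a) * 2 + b * 3 ≡ a * 2 + (2 + b) * 3
three-twos≡two-threes = solve-∀

a+[2+b]≡2+[a+b] : ∀ a b → a + (2 + b) ≡ 2 + (a + b)
a+[2+b]≡2+[a+b] = solve-∀

twosThrees-exchange : ∀ {d} a b → a * 2 + b * 3 ≡ 2 + d → 1 ≤ d →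
  (∃₂ λ a' b' → a' * 2 + b' * 3 ≡ 2 + d × a' + b' ≢ a + b) ⊎ (d ≡ 1 ⊎ d ≡ 2 ⊎ d ≡ 3 ⊎ d ≡ 5)
twosThrees-exchange (suc (suc (suc a))) b sum≡ _ =
  inj₁ ( a , 2 + b , trans (sym (three-twos≡two-threes a b)) sum≡
       , λ length≡ → 1+n≢n (sym (trans (sym (a+[2+b]≡2+[a+b] a b)) length≡)))
twosThrees-exchange a (suc (suc b)) sum≡ _ =
  inj₁ ( 3 + a , b , trans (three-twos≡two-threes a b) sum≡
       , λ length≡ → 1+n≢n (trans length≡ (a+[2+b]≡2+[a+b] a b)))
twosThrees-exchange 0 0 () _
twosThrees-exchange 0 1 refl _ = inj₂ (inj₁ refl)
twosThrees-exchange 1 0 refl ()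
twosThrees-exchange 1 1 refl _ = inj₂ (inj₂ (inj₂ (inj₁ refl)))
twosThrees-exchange 2 0 refl _ = inj₂ (inj₂ (inj₁ refl))
twosThrees-exchange 2 1 refl _ = inj₂ (inj₂ (inj₂ (inj₂ refl)))

length-bounds : ∀ d r → d ∸ 1 ≤ 3 * r → 2 * r ≤ d → suc r * 2 ≤ d + 2 × d + 2 ≤ suc r * 3
length-bounds d r d-1≤3r 2r≤d = lower , upper
  where
  open ≤-Reasoning
  lower : suc r * 2 ≤ d + 2
  lower = begin
    2 + r * 2  ≡⟨ cong (_+_ 2) (*-comm r 2) ⟩
    2 + 2 * r  ≤⟨ +-monoʳ-≤ 2 2r≤d ⟩
    2 + d      ≡⟨ +-comm 2 d ⟩
    d + 2      ∎
  upper : d + 2 ≤ suc r * 3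
  upper = begin
    d + 2                ≤⟨ +-monoˡ-≤ 2 (m≤n+m∸n d 1) ⟩
    1 + (d ∸ 1) + 2      ≤⟨ +-monoˡ-≤ 2 (+-monoʳ-≤ 1 d-1≤3r) ⟩
    1 + 3 * r + 2        ≡⟨ regroup r ⟩
    suc r * 3            ∎
    where
    regroup : ∀ r → 1 + 3 * r + 2 ≡ suc r * 3
    regroup = solve-∀

module _ {p : ℕ} (p∤2 : ¬ p ∣ 2) where

  p∤1 : ¬ p ∣ 1
  p∤1 p∣1 = p∤2 (∣-trans p∣1 (1∣ 2))

  twoOrThree⇒admissible : ∀ {e} → TwoOrThree e → AdmissibleEntry p e
  twoOrThree⇒admissible (inj₁ refl) = s≤s z≤n , p∤1
  twoOrThree⇒admissible (inj₂ refl) = s≤s z≤n , p∤2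

  admissible-split : ∀ {e} → AdmissibleEntry p e → ¬ TwoOrThree e →
                     ∃₂ λ e₁ e₂ → AdmissibleEntry p e₁ × AdmissibleEntry p e₂ × e₁ + e₂ ≡ e
  admissible-split {zero} (() , _) _
  admissible-split {suc zero} (_ , p∤0) _ = contradiction (p ∣0) p∤0
  admissible-split {2} _ ¬2or3 = contradiction (inj₁ refl) ¬2or3
  admissible-split {3} _ ¬2or3 = contradiction (inj₂ refl) ¬2or3
  admissible-split {suc (suc (suc (suc k)))} _ _ with p ∣? suc k
  ... | no p∤1+k = 2 , 2 + k , twoOrThree⇒admissible (inj₁ refl) , (s≤s z≤n , p∤1+k) , refl
  ... | yes p∣1+k = 3 , 1 + k , twoOrThree⇒admissible (inj₂ refl) , (s≤s z≤n , p∤k) , refl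
    where
    p∤k : ¬ p ∣ k
    p∤k p∣k = p∤1 (∣m+n∣m⇒∣n (subst (p ∣_) (+-comm 1 k) p∣1+k) p∣k)

  split-non-twoOrThree : ∀ {E} → All (AdmissibleEntry p) E → ¬ All TwoOrThree E →
    ∃ λ E' → All (AdmissibleEntry p) E' × sum E' ≡ sum E × length E' ≡ suc (length E) × Refines E' E
  split-non-twoOrThree {E} admE ¬2or3
    with e , e∈E , e∉2or3 ← find (All.¬All⇒Any¬ twoOrThree? E ¬2or3)
    with e₁ , e₂ , adm₁ , adm₂ , refl ← admissible-split (All.lookup admE e∈E) e∉2or3
    with xs , ys , refl ← ∈-∃++ e∈E =
      e₁ ∷ e₂ ∷ xs ++ ys
    , adm₁ ∷ adm₂ ∷ All.tail (All-resp-↭ π admE)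
    , trans (sym (+-assoc e₁ e₂ (sum (xs ++ ys)))) (sum-↭ (↭-sym π))
    , cong suc (sym (↭-length π))
    , refines-split e₁ e₂ (xs ++ ys) π
    where
    π : xs ++ [ e₁ + e₂ ] ++ ys ↭ e₁ + e₂ ∷ xs ++ ys
    π = shift (e₁ + e₂) xs ys

  module _ (d : ℕ) where

    maximal⇒twoOrThree : ∀ {E} → Maximal p d E → All TwoOrThree E
    maximal⇒twoOrThree {E} ((admE , sumE) , maximal) with all? twoOrThree? E
    ... | yes 2or3 = 2or3
    ... | no ¬2or3 with E' , admE' , sum≡ , length≡ , refines ← split-non-twoOrThree admE ¬2or3 =
      contradiction (trans (sym length≡) (↭-length (maximal E' (admE' , trans sum≡ sumE) refines))) 1+n≢n

    twoOrThree⇒maximal : ∀ {E} → All TwoOrThree E → sum E ≡ d + 2 → Maximal p d E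
    twoOrThree⇒maximal 2or3 sumE =
        (All.map twoOrThree⇒admissible 2or3 , sumE)
      , λ E' (admE' , _) → refinement-of-twoOrThree (All.map admissible⇒2≤ admE') 2or3

    maximal⇔twoOrThree : ∀ {E} → InΩ p d E → Maximal p d E ⇔ All TwoOrThree E
    maximal⇔twoOrThree (_ , sumE) = mk⇔ maximal⇒twoOrThree (λ 2or3 → twoOrThree⇒maximal 2or3 sumE)

    maximal-of-length : ∀ n → n * 2 ≤ d + 2 → d + 2 ≤ n * 3 → ∃ λ E → Maximal p d E × length E ≡ n
    maximal-of-length n n*2≤ ≤n*3 with 2or3 , sum≡ , length≡ ← ofLength-spec n*2≤ ≤n*3 =
      _ , twoOrThree⇒maximal 2or3 sum≡ , length≡

    maximal-↭ : ∀ {E E'} → Maximal p d E → Maximal p d E' → length E ≡ length E' → E ↭ E'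
    maximal-↭ maxE maxE' =
      twoOrThree-↭ (maximal⇒twoOrThree maxE) (maximal⇒twoOrThree maxE')
                   (trans (proj₂ (proj₁ maxE)) (sym (proj₂ (proj₁ maxE'))))

    maximalPartitions-sound : All (Maximal p d) (twoThreePartitions (d + 2))
    maximalPartitions-sound =
      All.map (λ (2or3 , sum≡) → twoOrThree⇒maximal 2or3 sum≡) (twoThreePartitions-sound (d + 2))

    maximalPartitions-complete : ∀ E → Maximal p d E → Any (E ↭_) (twoThreePartitions (d + 2))
    maximalPartitions-complete E maxE =
      twoThreePartitions-complete (d + 2) (maximal⇒twoOrThree maxE) (proj₂ (proj₁ maxE))

    singleton⇒unique-maximal : ∀ {M} → twoThreePartitions (d + 2) ≡ M ∷ [] →
      ∃ λ E → Maximal p d E × (∀ E' → Maximal p d E' → E' ↭ E)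
    singleton⇒unique-maximal {M} eq =
        M , All.head (subst (All (Maximal p d)) eq maximalPartitions-sound)
      , λ E' maxE' → the-only (subst (Any (E' ↭_)) eq (maximalPartitions-complete E' maxE'))
      where
      the-only : ∀ {E'} → Any (E' ↭_) (M ∷ []) → E' ↭ M
      the-only (here π) = π

    unique-maximal⇒small : 1 ≤ d → (∃ λ E → Maximal p d E × (∀ E' → Maximal p d E' → E' ↭ E)) →
                           d ≡ 1 ⊎ d ≡ 2 ⊎ d ≡ 3 ⊎ d ≡ 5
    unique-maximal⇒small 1≤d (E , maxE , unique)
      with a , b , π ← ↭-twosThrees (maximal⇒twoOrThree maxE)
      with twosThrees-exchange a b sum≡ 1≤d
      where
      sum≡ : a * 2 + b * 3 ≡ 2 + d
      sum≡ = trans (sym (sum-twosThrees a b)) (trans (sym (sum-↭ π)) (trans (proj₂ (proj₁ maxE)) (+-comm d 2)))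
    ... | inj₂ small = small
    ... | inj₁ (a' , b' , sum' , length≢) = contradiction length≡ length≢
      where
      maxE' : Maximal p d (twosThrees a' b')
      maxE' = twoOrThree⇒maximal (twosThrees-twoOrThree a' b') (trans (sum-twosThrees a' b') (trans sum' (+-comm 2 d)))
      length≡ : a' + b' ≡ a + b
      length≡ = trans (sym (length-twosThrees a' b'))
                (trans (↭-length (unique _ maxE')) (trans (↭-length π) (length-twosThrees a b)))

  -- For these d, twoThreePartitions (d + 2) evaluates to a one-element list.
  small⇒unique-maximal : ∀ {d} → d ≡ 1 ⊎ d ≡ 2 ⊎ d ≡ 3 ⊎ d ≡ 5 →
                         ∃ λ E → Maximal p d E × (∀ E' → Maximal p d E' → E' ↭ E)
  small⇒unique-maximal (inj₁ refl) = singleton⇒unique-maximal 1 refl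
  small⇒unique-maximal (inj₂ (inj₁ refl)) = singleton⇒unique-maximal 2 refl
  small⇒unique-maximal (inj₂ (inj₂ (inj₁ refl))) = singleton⇒unique-maximal 3 refl
  small⇒unique-maximal (inj₂ (inj₂ (inj₂ refl))) = singleton⇒unique-maximal 5 refl

lemma2p4 : (p d : ℕ) → Prime p → 3 ≤ p → 1 ≤ d →
    ((E : List ℕ) → InΩ p d E → (Maximal p d E ⇔ All (λ e → e ≡ 2 ⊎ e ≡ 3) E))
    × ((r : ℕ) → d ∸ 1 ≤ 3 * r → 2 * r ≤ d →
        (∃ λ E → Maximal p d E × length E ≡ suc r)
        × ((E E' : List ℕ) → Maximal p d E → Maximal p d E' →
            length E ≡ suc r → length E' ≡ suc r → E ↭ E'))
    × (∃ λ (Ms : List (List ℕ)) →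
        All (Maximal p d) Ms
        × AllPairs (λ E E' → ¬ (E ↭ E')) Ms
        × ((E : List ℕ) → Maximal p d E → Any (λ M → E ↭ M) Ms)
        × (+ length Ms ≡ (+ (d / 2)) ℤ.- ceilDiv3 ((+ d) ℤ.- (+ 4))))
    × ((∃ λ E → Maximal p d E × ((E' : List ℕ) → Maximal p d E' → E' ↭ E))
        ⇔ (d ≡ 1 ⊎ d ≡ 2 ⊎ d ≡ 3 ⊎ d ≡ 5))
lemma2p4 p d _ 3≤p 1≤d =
    (λ _ → maximal⇔twoOrThree p∤2 d)
  , (λ r d-1≤3r 2r≤d → let lower , upper = length-bounds d r d-1≤3r 2r≤d in
        maximal-of-length p∤2 d (suc r) lower upper
      , λ _ _ maxE maxE' length≡ length≡' → maximal-↭ p∤2 d maxE maxE' (trans length≡ (sym length≡')))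
  , ( twoThreePartitions (d + 2)
    , maximalPartitions-sound p∤2 d
    , twoThreePartitions-distinct (d + 2)
    , maximalPartitions-complete p∤2 d
    , trans (cong +_ (length-twoThreePartitions (d + 2))) (count-formula d))
  , mk⇔ (unique-maximal⇒small p∤2 d 1≤d) (small⇒unique-maximal p∤2)
  where
  p∤2 : ¬ p ∣ 2
  p∤2 p∣2 = ≤⇒≯ (∣⇒≤ p∣2) 3≤p
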